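{- Let $s\ge 2$ and $t$ be integers and put $g=\frac{s-1}{\gcd(s-1,t)}$. Let $r\ge 2$ be an integer with $\gcd(r,s)=1$. Then $r$ is distinguished with respect to $(s,t)$ if and only if $\operatorname{ord}_r(s)=\operatorname{ord}_{gr}(s)$.
   Context: For integers $s$ and $r\ge 1$ with $\gcd(r,s)=1$, $\operatorname{ord}_r(s)$ denotes the least positive integer $m$ with $s^m\equiv 1\pmod r$. For integers $s\ge 2$ and $t$, an integer $r\ge 2$ is distinguished with respect to $(s,t)$ if $\gcd(r,s)=1$ and $r$ divides $t\cdot\frac{s^{\operatorname{ord}_r(s)}-1}{s-1}$. Here $\gcd(s-1,0)=s-1$. -}

module Defs where

open import Data.Nat using (ℕ; s≤s; zero; suc; _∸_; _^_; _*_; _≤_; _<_; NonZero; ≢-nonZero)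
open import Data.Nat.Divisibility using (_∣_)
open import Data.Nat.DivMod using (_/_)
open import Data.Nat.GCD using (gcd; gcd[m,n]≢0)
open import Data.Nat.Coprimality using (Coprime)
open import Data.Integer as ℤ using (ℤ; +_; ∣_∣)
import Data.Integer.Divisibility as ℤD
open import Data.Product using (_×_; Σ-syntax)
open import Data.Sum using (inj₁)
open import Relation.Nullary using (¬_)

s∸1-nonZero : (s : ℕ) → 2 ≤ s → NonZero (s ∸ 1)
s∸1-nonZero (suc zero) (s≤s ())
s∸1-nonZero (suc (suc k)) _ = _

-- IsOrd r s m : m is the least positive integer with s^m ≡ 1 (mod r),
-- i.e. m = ord_r(s).  (s^m ≡ 1 mod r is written r ∣ s^m - 1; s ≥ 1 so s^m ≥ 1.)
IsOrd : ℕ → ℕ → ℕ → Set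
IsOrd r s m = 1 ≤ m × r ∣ (s ^ m ∸ 1) × (∀ k → 1 ≤ k → k < m → ¬ (r ∣ (s ^ k ∸ 1)))

repQuot : (s : ℕ) → 2 ≤ s → ℕ → ℕ
repQuot s h m = _/_ (s ^ m ∸ 1) (s ∸ 1) {{s∸1-nonZero s h}}

-- g = (s - 1) / gcd(s - 1, t)   (stdlib: gcd n 0 = n, matching gcd(s-1,0) = s-1)
gOf : (s : ℕ) → 2 ≤ s → ℤ → ℕ
gOf (suc zero) (s≤s ()) t
gOf (suc (suc k)) _ t =
  _/_ (suc k) (gcd (suc k) ∣ t ∣) {{≢-nonZero (gcd[m,n]≢0 (suc k) ∣ t ∣ (inj₁ (λ ())))}}

Distinguished : (s : ℕ) → 2 ≤ s → ℤ → ℕ → Set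
Distinguished s h t r =
  Coprime r s × Σ[ m ∈ ℕ ] (IsOrd r s m × (+ r) ℤD.∣ (t ℤ.* + (repQuot s h m)))

{-# OPTIONS --safe #-}
module Submission where

open import Defs
open import Data.Nat using (ℕ; zero; suc; _+_; _*_; _∸_; _^_; _≤_; s≤s; NonZero; ≢-nonZero; >-nonZero)
open import Data.Nat.Properties using (*-zeroʳ; *-comm; *-assoc; *-distribˡ-+; +-suc; +-comm)
open import Data.Nat.Divisibility using (_∣_; ∣-trans; n∣m*n; m*n∣⇒n∣; *-monoʳ-∣; *-cancelˡ-∣; ∣⇒≤)
open import Data.Nat.DivMod using (_/_; m/n*n≡m; m*n/n≡m; m≥n⇒m/n>0)
open import Data.Nat.GCD using (gcd; gcd[m,n]≢0; gcd[m,n]∣m; gcd[m,n]∣n)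
open import Data.Nat.Coprimality using (Coprime; coprime-/gcd; coprime-factors)
open import Data.Integer as ℤ using (ℤ; +_; ∣_∣)
open import Data.Integer.Properties using (abs-*)
open import Data.Product using (_×_; Σ-syntax; _,_)
open import Data.Sum using (inj₁)
open import Function.Bundles using (_⇔_; mk⇔; Equivalence)
open import Relation.Binary.PropositionalEquality using (_≡_; sym; subst; cong; cong₂; module ≡-Reasoning)

-- Write s = 1 + d, d = g c and |t| = t′ c with c = gcd(d, |t|), so that gcd(g, t′) = 1.  With
-- G = c (s^m - 1)/d we get s^m - 1 = g G and |t| (s^m - 1)/d = t′ G.  If r ∣ s^m - 1 = g G, then
-- coprimality of g and t′ shows that r ∣ t′ G, r ∣ G and g r ∣ g G are all equivalent; and g r ∣ s^m - 1
-- forces ord_{gr}(s) = ord_r(s) = m, because r ∣ g r.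

geometricSum : ℕ → ℕ → ℕ
geometricSum d zero    = 0
geometricSum d (suc m) = suc d ^ m + geometricSum d m

suc[*geometricSum]≡^ : ∀ d m → suc (d * geometricSum d m) ≡ suc d ^ m
suc[*geometricSum]≡^ d zero    = cong suc (*-zeroʳ d)
suc[*geometricSum]≡^ d (suc m) = begin
  suc (d * (suc d ^ m + geometricSum d m))      ≡⟨ cong suc (*-distribˡ-+ d (suc d ^ m) _) ⟩
  suc (d * suc d ^ m + d * geometricSum d m)    ≡⟨ sym (+-suc (d * suc d ^ m) _) ⟩
  d * suc d ^ m + suc (d * geometricSum d m)    ≡⟨ cong (_+_ (d * suc d ^ m)) (suc[*geometricSum]≡^ d m) ⟩
  d * suc d ^ m + suc d ^ m                     ≡⟨ +-comm (d * suc d ^ m) _ ⟩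
  suc d * suc d ^ m                             ∎
  where open ≡-Reasoning

^∸1≡*geometricSum : ∀ d m → suc d ^ m ∸ 1 ≡ d * geometricSum d m
^∸1≡*geometricSum d m = cong (_∸ 1) (sym (suc[*geometricSum]≡^ d m))

repQuot≡geometricSum : ∀ k hs m → repQuot (suc (suc k)) hs m ≡ geometricSum (suc k) m
repQuot≡geometricSum k hs m = begin
  (suc (suc k) ^ m ∸ 1) / suc k         ≡⟨ cong (_/ suc k) (^∸1≡*geometricSum (suc k) m) ⟩
  suc k * geometricSum (suc k) m / suc k ≡⟨ cong (_/ suc k) (*-comm (suc k) (geometricSum (suc k) m)) ⟩
  geometricSum (suc k) m * suc k / suc k ≡⟨ m*n/n≡m (geometricSum (suc k) m) (suc k) ⟩
  geometricSum (suc k) m                 ∎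
  where open ≡-Reasoning

coprime⇒∣*⇔*∣* : ∀ {a b r x} .{{_ : NonZero a}} → Coprime a b → r ∣ a * x →
                 (r ∣ b * x) ⇔ (a * r ∣ a * x)
coprime⇒∣*⇔*∣* {a} {b} coprime r∣ax = mk⇔
  (λ r∣bx → *-monoʳ-∣ a (coprime-factors coprime (r∣ax , r∣bx)))
  (λ ar∣ax → ∣-trans (*-cancelˡ-∣ a ar∣ax) (n∣m*n b))

IsOrd⇒∣^∸1 : ∀ {r s m} → IsOrd r s m → r ∣ s ^ m ∸ 1
IsOrd⇒∣^∸1 (_ , r∣ , _) = r∣

IsOrd-*ˡ : ∀ {r s m} g → IsOrd r s m → g * r ∣ s ^ m ∸ 1 → IsOrd (g * r) s m
IsOrd-*ˡ {r} g (m≥1 , _ , minimal) gr∣ =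
  m≥1 , gr∣ , λ k k≥1 k<m gr∣k → minimal k k≥1 k<m (m*n∣⇒n∣ g r gr∣k)

module _ (k : ℕ) (hs : 2 ≤ suc (suc k)) (t : ℤ) where
  private
    d = suc k
    c = gcd d ∣ t ∣
    instance
      c≢0 : NonZero c
      c≢0 = ≢-nonZero (gcd[m,n]≢0 d ∣ t ∣ (inj₁ (λ ())))
    g = gOf (suc d) hs t
    t′ = ∣ t ∣ / c
    instance
      g≢0 : NonZero g
      g≢0 = >-nonZero (m≥n⇒m/n>0 (∣⇒≤ (gcd[m,n]∣m d ∣ t ∣)))

  ^∸1≡gOf*[gcd*geometricSum] : ∀ m → suc d ^ m ∸ 1 ≡ g * (c * geometricSum d m)
  ^∸1≡gOf*[gcd*geometricSum] m = begin
    suc d ^ m ∸ 1              ≡⟨ ^∸1≡*geometricSum d m ⟩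
    d * geometricSum d m       ≡⟨ cong (_* geometricSum d m) (sym (m/n*n≡m (gcd[m,n]∣m d ∣ t ∣))) ⟩
    g * c * geometricSum d m   ≡⟨ *-assoc g c _ ⟩
    g * (c * geometricSum d m) ∎
    where open ≡-Reasoning

  ∣t*repQuot∣≡[∣t∣/gcd]*[gcd*geometricSum] : ∀ m →
    ∣ t ℤ.* + repQuot (suc d) hs m ∣ ≡ t′ * (c * geometricSum d m)
  ∣t*repQuot∣≡[∣t∣/gcd]*[gcd*geometricSum] m = begin
    ∣ t ℤ.* + repQuot (suc d) hs m ∣ ≡⟨ abs-* t _ ⟩
    ∣ t ∣ * repQuot (suc d) hs m     ≡⟨ cong₂ _*_ (sym (m/n*n≡m (gcd[m,n]∣n d ∣ t ∣))) (repQuot≡geometricSum k hs m) ⟩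
    t′ * c * geometricSum d m        ≡⟨ *-assoc t′ c _ ⟩
    t′ * (c * geometricSum d m)      ∎
    where open ≡-Reasoning

  ∣t*repQuot∣⇔gOf*∣^∸1 : ∀ {r} m → r ∣ suc d ^ m ∸ 1 →
    (r ∣ (∣ t ℤ.* + repQuot (suc d) hs m ∣)) ⇔ (g * r ∣ suc d ^ m ∸ 1)
  ∣t*repQuot∣⇔gOf*∣^∸1 {r} m r∣ = mk⇔
    (λ r∣tq → subst (g * r ∣_) (sym ^∸1≡) (to (subst (r ∣_) ∣t*repQuot∣≡ r∣tq)))
    (λ gr∣ → subst (r ∣_) (sym ∣t*repQuot∣≡) (from (subst (g * r ∣_) ^∸1≡ gr∣)))
    where
    ^∸1≡ = ^∸1≡gOf*[gcd*geometricSum] m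
    ∣t*repQuot∣≡ = ∣t*repQuot∣≡[∣t∣/gcd]*[gcd*geometricSum] m
    open Equivalence (coprime⇒∣*⇔*∣* (coprime-/gcd d ∣ t ∣) (subst (r ∣_) ^∸1≡ r∣))

proposition3p2 : (s : ℕ) (hs : 2 ≤ s) (t : ℤ) (r : ℕ) → 2 ≤ r → Coprime r s →
    Distinguished s hs t r ⇔ (Σ[ m ∈ ℕ ] (IsOrd r s m × IsOrd (gOf s hs t * r) s m))
proposition3p2 (suc zero) (s≤s ()) t r _ _
proposition3p2 (suc (suc k)) hs t r _ coprime = mk⇔
  (λ (_ , m , ord , r∣t*q) → m , ord , IsOrd-*ˡ g ord (Equivalence.to (criterion ord) r∣t*q))
  (λ (m , ord , ord′) → coprime , m , ord , Equivalence.from (criterion ord) (IsOrd⇒∣^∸1 ord′))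
  where
  g = gOf (suc (suc k)) hs t
  criterion : ∀ {m} → IsOrd r (suc (suc k)) m →
    (r ∣ (∣ t ℤ.* + repQuot (suc (suc k)) hs m ∣)) ⇔ (g * r ∣ suc (suc k) ^ m ∸ 1)
  criterion {m} ord = ∣t*repQuot∣⇔gOf*∣^∸1 k hs t m (IsOrd⇒∣^∸1 ord)
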